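{- Let $a,k\in\mathbb N$ and let $b$ be an integer with $0\le b<a$. Then $c_{a,\,ak+c_{a,k}-b}=k$.
   Context: $\mathbb N=\{1,2,3,\dots\}$. For $a\in\mathbb N$ the sequence $(c_{a,n})_{n\ge 0}$ is defined by $c_{a,0}=0$, $c_{a,1}=1$, and $c_{a,n}=\min\{k<n : ak+c_{a,k}\ge n\}$ for $n\ge 2$. -}

module Defs where

open import Data.Nat using (ℕ; zero; suc; _+_; _*_; _≤?_)
open import Data.List using (List; []; _∷_; _++_; [_])
open import Relation.Nullary using (yes; no)

-- firstIdx a n k L : with L = [c_{a,k}, c_{a,k+1}, ...], return the least
-- index j ≥ k (among the listed ones) with a*j + c_{a,j} ≥ n.
-- (The default value 0 for "no such index" is never used: for a ≥ 1 and
-- n ≥ 2, k = n-1 always qualifies since c_{a,n-1} ≥ 1.)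
firstIdx : ℕ → ℕ → ℕ → List ℕ → ℕ
firstIdx a n k [] = 0
firstIdx a n k (ck ∷ L) with n ≤? a * k + ck
... | yes _ = k
... | no  _ = firstIdx a n (suc k) L

extend : ℕ → ℕ → List ℕ → List ℕ
extend a n T = T ++ [ firstIdx a n 0 T ]

-- cTable a n = [c_{a,0}, c_{a,1}, ..., c_{a,n}]
cTable : ℕ → ℕ → List ℕ
cTable a zero = 0 ∷ []
cTable a (suc zero) = 0 ∷ 1 ∷ []
cTable a (suc (suc m)) = extend a (suc (suc m)) (cTable a (suc m))

lastOr : ℕ → List ℕ → ℕ
lastOr d [] = d
lastOr d (x ∷ L) = lastOr x L

c : ℕ → ℕ → ℕ
c a n = lastOr 0 (cTable a n)

-- Write reach k = a k + c_{a,k}, so that c_{a,n} is the least k with n ≤ reach k.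
-- Since c_{a,k} ≥ 1 for k ≥ 1, the index n - 1 always qualifies, and comparing
-- the least indices for n and n + 1 shows that c_{a,·} is non-decreasing. Hence
-- reach j + a ≤ reach k whenever j < k, so for 0 ≤ b < a the number reach k - b
-- exceeds every reach j with j < k while not exceeding reach k: its least index is k.
module Submission where

open import Defs
open import Data.Nat using (ℕ; zero; suc; _+_; _*_; _∸_; _≤_; _<_; _≥_; _≤?_; z≤n; s≤s; >-nonZero)
open import Data.Nat.Properties
open import Data.List using (List; []; _∷_; _++_; [_])
open import Data.Product using (_×_; _,_; proj₁)
open import Data.Sum using (inj₁; inj₂)
open import Relation.Nullary using (yes; no; contradiction)
open import Relation.Binary.PropositionalEquality using (_≡_; refl; sym; cong; subst; module ≡-Reasoning)

lastOr-++-[] : ∀ d xs x → lastOr d (xs ++ [ x ]) ≡ x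
lastOr-++-[] d []       x = refl
lastOr-++-[] d (y ∷ xs) x = lastOr-++-[] y xs x

window : (ℕ → ℕ) → ℕ → ℕ → List ℕ
window g k zero      = []
window g k (suc len) = g k ∷ window g (suc k) len

window-suc : ∀ g k len → window g k (suc len) ≡ window g k len ++ [ g (k + len) ]
window-suc g k zero      = cong (λ i → g i ∷ []) (sym (+-identityʳ k))
window-suc g k (suc len) rewrite +-suc k len = cong (g k ∷_) (window-suc g (suc k) len)

firstIdx-window : ∀ {a n} g k len {w} → k ≤ w → w < k + len → n ≤ a * w + g w →
  let r = firstIdx a n k (window g k len) in
  n ≤ a * r + g r × (∀ {j} → k ≤ j → j < r → a * j + g j < n)
firstIdx-window g k zero {w} k≤w w<k+0 _ =
  contradiction k≤w (<⇒≱ (subst (w <_) (+-identityʳ k) w<k+0))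
firstIdx-window {a} {n} g k (suc len) {w} k≤w w<k+len+1 n≤gw with n ≤? a * k + g k
... | yes n≤gk = n≤gk , λ k≤j j<k → contradiction k≤j (<⇒≱ j<k)
... | no n≰gk with m≤n⇒m<n∨m≡n k≤w
...   | inj₂ refl = contradiction n≤gw n≰gk
...   | inj₁ k<w with firstIdx-window g (suc k) len k<w (subst (w <_) (+-suc k len) w<k+len+1) n≤gw
...     | n≤gr , below = n≤gr , below′
  where
  below′ : ∀ {j} → k ≤ j → j < firstIdx a n (suc k) (window g (suc k) len) → a * j + g j < n
  below′ k≤j j<r with m≤n⇒m<n∨m≡n k≤j
  ... | inj₁ k<j = below k<j j<r
  ... | inj₂ refl = ≰⇒> n≰gk

module _ (a : ℕ) where

  reach : ℕ → ℕ
  reach j = a * j + c a j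

  IsLeast : ℕ → ℕ → Set
  IsLeast n r = n ≤ reach r × (∀ {j} → j < r → reach j < n)

  least-mono : ∀ {n n′ r r′} → n ≤ n′ → IsLeast n r → IsLeast n′ r′ → r ≤ r′
  least-mono n≤n′ (_ , below) (n′≤reach , _) =
    ≮⇒≥ λ r′<r → <⇒≱ (below r′<r) (≤-trans n≤n′ n′≤reach)

  least-unique : ∀ {n r r′} → IsLeast n r → IsLeast n r′ → r ≡ r′
  least-unique p q = ≤-antisym (least-mono ≤-refl p q) (least-mono ≤-refl q p)

  c-last : ∀ m → c a (suc (suc m)) ≡ firstIdx a (suc (suc m)) 0 (cTable a (suc m))
  c-last m = lastOr-++-[] 0 (cTable a (suc m)) _

  cTable-window : ∀ m → cTable a m ≡ window (c a) 0 (suc m)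
  cTable-window zero          = refl
  cTable-window (suc zero)    = refl
  cTable-window (suc (suc m)) = begin
    T ++ [ firstIdx a (suc (suc m)) 0 T ]                  ≡⟨ cong (λ x → T ++ [ x ]) (sym (c-last m)) ⟩
    T ++ [ c a (suc (suc m)) ]                             ≡⟨ cong (_++ [ c a (suc (suc m)) ]) (cTable-window (suc m)) ⟩
    window (c a) 0 (suc (suc m)) ++ [ c a (suc (suc m)) ]  ≡⟨ sym (window-suc (c a) 0 (suc (suc m))) ⟩
    window (c a) 0 (suc (suc (suc m)))                     ∎
    where
    open ≡-Reasoning
    T = cTable a (suc m)

  c-isLeast-of-witness : ∀ {n w} → 2 ≤ n → w < n → n ≤ reach w → IsLeast n (c a n)
  c-isLeast-of-witness {suc (suc m)} (s≤s (s≤s z≤n)) w<n n≤reach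
    rewrite c-last m | cTable-window (suc m)
    with firstIdx-window {a} (c a) 0 (suc (suc m)) z≤n w<n n≤reach
  ... | n≤reach-r , below = n≤reach-r , below z≤n

  reach-zero : reach 0 ≡ 0
  reach-zero = cong (_+ 0) (*-zeroʳ a)

  index-pos : ∀ {n r} → 1 ≤ n → n ≤ reach r → 1 ≤ r
  index-pos {r = zero}  1≤n n≤reach = contradiction (subst (1 ≤_) reach-zero (≤-trans 1≤n n≤reach)) λ ()
  index-pos {r = suc r} _   _       = s≤s z≤n

module _ {a : ℕ} (a≥1 : a ≥ 1) where

  reach-suc-lower : ∀ m → 1 ≤ c a (suc m) → a + suc m ≤ reach a (suc m)
  reach-suc-lower m 1≤c = begin
    a + suc m                   ≡⟨ +-suc a m ⟩
    suc (a + m)                 ≡⟨ +-comm 1 (a + m) ⟩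
    a + m + 1                   ≤⟨ +-mono-≤ (+-monoʳ-≤ a (m≤n*m m a {{>-nonZero a≥1}})) 1≤c ⟩
    a + a * m + c a (suc m)     ≡⟨ cong (_+ c a (suc m)) (sym (*-suc a m)) ⟩
    reach a (suc m)             ∎
    where open ≤-Reasoning

  reach-suc-exceeds : ∀ m → 1 ≤ c a (suc m) → suc (suc m) ≤ reach a (suc m)
  reach-suc-exceeds m 1≤c = ≤-trans (+-monoˡ-≤ (suc m) a≥1) (reach-suc-lower m 1≤c)

  c-pos : ∀ m → 1 ≤ c a (suc m)
  c-pos zero    = s≤s z≤n
  c-pos (suc m) = index-pos a (s≤s z≤n)
    (proj₁ (c-isLeast-of-witness a {suc (suc m)} (s≤s (s≤s z≤n)) ≤-refl (reach-suc-exceeds m (c-pos m))))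

  c-isLeast : ∀ {n} → 2 ≤ n → IsLeast a n (c a n)
  c-isLeast {suc (suc m)} 2≤n@(s≤s (s≤s z≤n)) = c-isLeast-of-witness a 2≤n ≤-refl (reach-suc-exceeds m (c-pos m))

  c-mono : ∀ n → c a n ≤ c a (suc n)
  c-mono zero          = z≤n
  c-mono (suc zero)    = c-pos 1
  c-mono (suc (suc m)) = least-mono a (n≤1+n _)
    (c-isLeast {suc (suc m)} (s≤s (s≤s z≤n)))
    (c-isLeast {suc (suc (suc m))} (s≤s (s≤s z≤n)))

  reach-step : ∀ j → reach a j + a ≤ reach a (suc j)
  reach-step j = begin
    a * j + c a j + a           ≡⟨ +-comm (a * j + c a j) a ⟩
    a + (a * j + c a j)         ≤⟨ +-monoʳ-≤ a (+-monoʳ-≤ (a * j) (c-mono j)) ⟩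
    a + (a * j + c a (suc j))   ≡⟨ sym (+-assoc a (a * j) (c a (suc j))) ⟩
    a + a * j + c a (suc j)     ≡⟨ cong (_+ c a (suc j)) (sym (*-suc a j)) ⟩
    reach a (suc j)             ∎
    where open ≤-Reasoning

  reach-gap : ∀ {j k} → j < k → reach a j + a ≤ reach a k
  reach-gap {j} {suc k} (s≤s j≤k) with m≤n⇒m<n∨m≡n j≤k
  ... | inj₂ refl = reach-step j
  ... | inj₁ j<k  = ≤-trans (reach-gap j<k) (≤-trans (m≤m+n (reach a k) a) (reach-step k))

  reach-∸-isLeast : ∀ k {b} → b < a → IsLeast a (reach a k ∸ b) k
  reach-∸-isLeast k {b} b<a = m∸n≤m (reach a k) b , below
    where
    below : ∀ {j} → j < k → reach a j < reach a k ∸ b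
    below {j} j<k = m+n≤o⇒m≤o∸n (suc (reach a j)) (begin
      suc (reach a j) + b       ≡⟨ sym (+-suc (reach a j) b) ⟩
      reach a j + suc b         ≤⟨ +-monoʳ-≤ (reach a j) b<a ⟩
      reach a j + a             ≤⟨ reach-gap j<k ⟩
      reach a k                 ∎)
      where open ≤-Reasoning

lemma1p3 : (a k b : ℕ) → a ≥ 1 → k ≥ 1 → b < a →
    c a (a * k + c a k ∸ b) ≡ k
lemma1p3 a (suc k) b a≥1 _ b<a =
  least-unique a (c-isLeast a≥1 2≤n) (reach-∸-isLeast a≥1 (suc k) b<a)
  where
  2≤n : 2 ≤ reach a (suc k) ∸ b
  2≤n = m+n≤o⇒m≤o∸n 2 (begin
    2 + b                    ≤⟨ s≤s b<a ⟩
    suc a                    ≤⟨ s≤s (m≤m+n a k) ⟩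
    suc (a + k)              ≡⟨ sym (+-suc a k) ⟩
    a + suc k                ≤⟨ reach-suc-lower a≥1 k (c-pos a≥1 k) ⟩
    reach a (suc k)          ∎)
    where open ≤-Reasoning
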